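{- Let $a,b,t$ be integers with $b\geq 2$, $t\geq 2$ and $t\leq a\leq b+t-2$. Then there exists $n_0=n_0(a,b,t)$ such that for all $n\geq n_0$ the following holds: if $\mathcal{F}\subset \binom{[n]}{a}$ and $\mathcal{G}\subset \binom{[n]}{b}$ are cross-intersecting families with $\tau(\mathcal{F})\geq 1$ and $\tau(\mathcal{G})\geq t$, then \[ |\mathcal{F}| + |\mathcal{G}| \leq \binom{n}{b} - \binom{n-a}{b} + 1. \]
   Context: $[n]=\{1,\dots,n\}$ and $\binom{[n]}{k}$ is the family of all $k$-element subsets of $[n]$. Two families $\mathcal{F},\mathcal{G}$ are cross-intersecting if $F\cap G\neq\emptyset$ for all $F\in\mathcal{F}$, $G\in\mathcal{G}$. For a family $\mathcal{F}$ of nonempty subsets of $[n]$, the covering number $\tau(\mathcal{F})$ is the minimum size of a set $T\subset[n]$ with $T\cap F\neq\emptyset$ for all $F\in\mathcal{F}$. -}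

module Defs where

open import Data.Nat using (ℕ; _≤_)
open import Data.Fin.Subset using (Subset; _∩_; Nonempty; ∣_∣)
open import Data.List using (List)
open import Data.List.Membership.Propositional using (_∈_)

-- A family of subsets of [n] is a duplicate-free list of subsets (Subset n).

CrossIntersecting : ∀ {n} → List (Subset n) → List (Subset n) → Set
CrossIntersecting {n} 𝓕 𝓖 =
  ∀ {F G : Subset n} → F ∈ 𝓕 → G ∈ 𝓖 → Nonempty (F ∩ G)

IsCover : ∀ {n} → Subset n → List (Subset n) → Set
IsCover {n} T 𝓕 = ∀ {F : Subset n} → F ∈ 𝓕 → Nonempty (T ∩ F)

-- τ(𝓕) ≥ t : every cover T of 𝓕 has at least t elements
-- (τ is the minimum size of a cover, so this is exactly τ(𝓕) ≥ t).
τ≥ : ∀ {n} → ℕ → List (Subset n) → Set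
τ≥ {n} t 𝓕 = ∀ (T : Subset n) → IsCover T 𝓕 → t ≤ ∣ T ∣

-- 𝓕 is nonempty since τ(𝓕) ≥ 1. If 𝓕 = {A}, every G ∈ 𝓖 meets A, so 𝓖 misses all
-- C(n−a, b) b-sets disjoint from A. Otherwise take A ≠ A′ in 𝓕 and x ∈ A ∖ A′: 𝓖 also
-- misses the C(n−a−1, b−1) b-sets through x disjoint from A′, while every F ∈ 𝓕 is a
-- cover of 𝓖. As 𝓖 is b-uniform with τ(𝓖) ≥ t, branching on the b points of a member
-- of 𝓖 not yet hit produces at most b^t sets of size t such that every cover of 𝓖
-- contains one of them; hence |𝓕| ≤ b^t C(n−t, a−t). This has degree a − t < b − 1 in
-- n, so for large n it is at most C(n−a−1, b−1), which pays for the extra sets in 𝓕.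

module Submission where

open import Defs
open import Data.Fin using (Fin; zero; suc)
open import Data.Fin.Subset
open import Data.Fin.Subset.Properties
open import Data.List using (List; []; _∷_; [_]; length; map; _++_; concatMap)
open import Data.List.Membership.Propositional using (find; lose) renaming (_∈_ to _∈ₗ_; _∉_ to _∉ₗ_)
open import Data.List.Membership.Propositional.Properties using (∈-∃++; ∈-++⁻; ∈-++⁺ˡ; ∈-++⁺ʳ; ∈-map⁺; ∈-map⁻)
open import Data.List.Properties using (length-++; length-map)
open import Data.List.Relation.Binary.Disjoint.Propositional using (Disjoint)
open import Data.List.Relation.Binary.Permutation.Propositional.Properties using (shift; ↭-length)
open import Data.List.Relation.Binary.Subset.Propositional using () renaming (_⊆_ to _⊆ₗ_)
open import Data.List.Relation.Unary.All as All using (All; []; _∷_)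
import Data.List.Relation.Unary.All.Properties as All
open import Data.List.Relation.Unary.AllPairs using ([]; _∷_)
open import Data.List.Relation.Unary.Any as Any using (Any)
import Data.List.Relation.Unary.Any.Properties as Any
open import Data.List.Relation.Unary.Unique.Propositional using (Unique)
import Data.List.Relation.Unary.Unique.Propositional.Properties as Unique
open import Data.Nat using (ℕ; zero; suc; _+_; _*_; _^_; _∸_; _!; _≤_; _<_; z≤n; s≤s; z<s)
open import Data.Nat.Combinatorics using (_C_; nCk+nC[k+1]≡[n+1]C[k+1]; nC1≡n)
open import Data.Nat.Properties
open import Algebra.Properties.CommutativeSemigroup *-commutativeSemigroup using (x∙yz≈y∙xz)
open import Data.Nat.Tactic.RingSolver using (solve-∀)
open import Data.Product using (∃; _×_; _,_; proj₁; proj₂)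
open import Data.Sum using (_⊎_; inj₁; inj₂)
open import Data.Vec using (_∷_; []; here; there)
open import Data.Vec.Properties using (∷-injectiveʳ)
open import Function using (_∘_)
open import Relation.Binary.PropositionalEquality using (_≡_; _≢_; refl; sym; trans; cong; cong₂; subst; subst₂; module ≡-Reasoning)
open import Relation.Nullary using (¬_; contradiction; yes; no)

C-pascal : ∀ n k → suc n C suc k ≡ n C k + n C suc k
C-pascal n k = sym (nCk+nC[k+1]≡[n+1]C[k+1] n k)

nCk≤n^k : ∀ n k → n C k ≤ n ^ k
nCk≤n^k n       zero    = ≤-refl
nCk≤n^k zero    (suc k) = z≤n
nCk≤n^k (suc n) (suc k) = begin
  suc n C suc k      ≡⟨ C-pascal n k ⟩
  n C k + n C suc k  ≤⟨ +-mono-≤ (nCk≤n^k n k) (nCk≤n^k n (suc k)) ⟩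
  suc n * n ^ k      ≤⟨ *-monoʳ-≤ (suc n) (^-monoˡ-≤ k (n≤1+n n)) ⟩
  suc n ^ suc k      ∎
  where open ≤-Reasoning

[1+k]*[1+n]C[1+k]≡[1+n]*nCk : ∀ n k → suc k * (suc n C suc k) ≡ suc n * (n C k)
[1+k]*[1+n]C[1+k]≡[1+n]*nCk zero    zero    = refl
[1+k]*[1+n]C[1+k]≡[1+n]*nCk zero    (suc k) = *-zeroʳ (2 + k)
[1+k]*[1+n]C[1+k]≡[1+n]*nCk (suc n) zero    =
  trans (+-identityʳ _) (trans (nC1≡n (2 + n)) (sym (*-identityʳ (2 + n))))
[1+k]*[1+n]C[1+k]≡[1+n]*nCk (suc n) (suc k) = begin
  (2 + k) * ((2 + n) C (2 + k))      ≡⟨ cong ((2 + k) *_) (C-pascal (suc n) (suc k)) ⟩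
  (2 + k) * (X + Y)                  ≡⟨ rearrange k X Y ⟩
  X + ((1 + k) * X + (2 + k) * Y)    ≡⟨ cong₂ (λ u v → X + (u + v))
                                          ([1+k]*[1+n]C[1+k]≡[1+n]*nCk n k)
                                          ([1+k]*[1+n]C[1+k]≡[1+n]*nCk n (suc k)) ⟩
  X + ((1 + n) * P + (1 + n) * Q)    ≡⟨ cong (X +_) (*-distribˡ-+ (1 + n) P Q) ⟨
  X + (1 + n) * (P + Q)              ≡⟨ cong (λ u → X + (1 + n) * u) (C-pascal n k) ⟨
  (2 + n) * X                        ∎
  where
  open ≡-Reasoning
  X = suc n C suc k
  Y = suc n C suc (suc k)
  P = n C k
  Q = n C suc k
  rearrange : ∀ k X Y → (2 + k) * (X + Y) ≡ X + ((1 + k) * X + (2 + k) * Y)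
  rearrange = solve-∀

[1+m]^k≤k!*[k+m]Ck : ∀ m k → suc m ^ k ≤ k ! * ((k + m) C k)
[1+m]^k≤k!*[k+m]Ck m zero    = ≤-refl
[1+m]^k≤k!*[k+m]Ck m (suc k) = begin
  suc m * suc m ^ k                      ≤⟨ *-monoʳ-≤ (suc m) ([1+m]^k≤k!*[k+m]Ck m k) ⟩
  suc m * (k ! * X)                      ≤⟨ *-monoˡ-≤ (k ! * X) (s≤s (m≤n+m m k)) ⟩
  suc (k + m) * (k ! * X)                ≡⟨ x∙yz≈y∙xz (suc (k + m)) (k !) X ⟩
  k ! * (suc (k + m) * X)                ≡⟨ cong (k ! *_) ([1+k]*[1+n]C[1+k]≡[1+n]*nCk (k + m) k) ⟨
  k ! * (suc k * (suc (k + m) C suc k))  ≡⟨ x∙yz≈y∙xz (k !) (suc k) _ ⟩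
  suc k * (k ! * (suc (k + m) C suc k))  ≡⟨ *-assoc (suc k) (k !) _ ⟨
  suc k ! * (suc (k + m) C suc k)        ∎
  where
  open ≤-Reasoning
  X = (k + m) C k

^-distrib-* : ∀ x y d → (x * y) ^ d ≡ x ^ d * y ^ d
^-distrib-* x y zero    = refl
^-distrib-* x y (suc d) = trans (cong ((x * y) *_) (^-distrib-* x y d)) (interchange x y (x ^ d) (y ^ d))
  where
  interchange : ∀ a b c e → a * b * (c * e) ≡ a * c * (b * e)
  interchange = solve-∀

module _ (B c d k : ℕ) (d<k : d < k) where

  C-dominates-poly-at : ∀ m → c + k + k ! * B * 2 ^ d ≤ m → B * (c + k + m) ^ d ≤ (k + m) C k
  C-dominates-poly-at m L≤m = *-cancelˡ-≤ (k !) {{k !≢0}} (begin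
    k ! * (B * (c + k + m) ^ d)          ≤⟨ *-monoʳ-≤ (k !) (*-monoʳ-≤ B (^-monoˡ-≤ d M≤2[1+m])) ⟩
    k ! * (B * (2 * suc m) ^ d)          ≡⟨ cong (λ z → k ! * (B * z)) (^-distrib-* 2 (suc m) d) ⟩
    k ! * (B * (2 ^ d * suc m ^ d))      ≡⟨ reassociate (k !) B (2 ^ d) (suc m ^ d) ⟩
    k ! * B * 2 ^ d * suc m ^ d          ≤⟨ *-monoˡ-≤ (suc m ^ d) (m≤n⇒m≤1+n (m+n≤o⇒n≤o (c + k) L≤m)) ⟩
    suc m ^ suc d                        ≤⟨ ^-monoʳ-≤ (suc m) d<k ⟩
    suc m ^ k                            ≤⟨ [1+m]^k≤k!*[k+m]Ck m k ⟩
    k ! * ((k + m) C k)                  ∎)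
    where
    open ≤-Reasoning
    reassociate : ∀ a b c e → a * (b * (c * e)) ≡ a * b * c * e
    reassociate = solve-∀
    M≤2[1+m] : c + k + m ≤ 2 * suc m
    M≤2[1+m] = begin
      c + k + m      ≤⟨ +-monoˡ-≤ m (m+n≤o⇒m≤o (c + k) L≤m) ⟩
      m + m          ≤⟨ +-mono-≤ (n≤1+n m) (n≤1+n m) ⟩
      suc m + suc m  ≡⟨ double (suc m) ⟩
      2 * suc m      ∎
      where
      double : ∀ x → x + x ≡ 2 * x
      double = solve-∀

  C-dominates-poly : ∃ λ N₀ → ∀ M → N₀ ≤ M → B * M ^ d ≤ (M ∸ c) C k
  C-dominates-poly = c + k + L , dominates
    where
    L = c + k + k ! * B * 2 ^ d
    dominates : ∀ M → c + k + L ≤ M → B * M ^ d ≤ (M ∸ c) C k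
    dominates M N₀≤M = subst₂ (λ M′ M′∸c → B * M′ ^ d ≤ M′∸c C k) M-split M∸c-split
                         (C-dominates-poly-at m L≤m)
      where
      m = M ∸ (c + k)
      M-split : c + k + m ≡ M
      M-split = m+[n∸m]≡n (m+n≤o⇒m≤o (c + k) N₀≤M)
      M∸c-split : k + m ≡ M ∸ c
      M∸c-split = trans (sym (m+n∸m≡n c (k + m))) (cong (_∸ c) (trans (sym (+-assoc c k m)) M-split))
      L≤m : L ≤ m
      L≤m = subst (_≤ m) (m+n∸m≡n (c + k) L) (∸-monoˡ-≤ (c + k) N₀≤M)

private variable
  n k : ℕ

unique-⊆⇒length≤ : ∀ {A : Set} {xs ys : List A} → Unique xs → xs ⊆ₗ ys → length xs ≤ length ys
unique-⊆⇒length≤ {xs = []}     _             _      = z≤n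
unique-⊆⇒length≤ {xs = x ∷ xs} (x∉xs ∷ uxs) xs⊆ys with ∈-∃++ (xs⊆ys (Any.here refl))
... | us , vs , refl = begin
  suc (length xs)        ≤⟨ s≤s (unique-⊆⇒length≤ uxs xs⊆us++vs) ⟩
  length (x ∷ us ++ vs)  ≡⟨ ↭-length (shift x us vs) ⟨
  length (us ++ x ∷ vs)  ∎
  where
  open ≤-Reasoning
  xs⊆us++vs : xs ⊆ₗ us ++ vs
  xs⊆us++vs z∈xs with ∈-++⁻ us (xs⊆ys (Any.there z∈xs))
  ... | inj₁ z∈us               = ∈-++⁺ˡ z∈us
  ... | inj₂ (Any.here refl)   = contradiction refl (All.lookup x∉xs z∈xs)
  ... | inj₂ (Any.there z∈vs)  = ∈-++⁺ʳ us z∈vs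

∣p─q∣+∣q∣≡∣p∣ : ∀ {p q : Subset n} → q ⊆ p → ∣ p ─ q ∣ + ∣ q ∣ ≡ ∣ p ∣
∣p─q∣+∣q∣≡∣p∣ {p = []}          {[]}          _   = refl
∣p─q∣+∣q∣≡∣p∣ {p = inside ∷ p}  {outside ∷ q} q⊆p = cong suc (∣p─q∣+∣q∣≡∣p∣ (drop-∷-⊆ q⊆p))
∣p─q∣+∣q∣≡∣p∣ {p = outside ∷ p} {outside ∷ q} q⊆p = ∣p─q∣+∣q∣≡∣p∣ (drop-∷-⊆ q⊆p)
∣p─q∣+∣q∣≡∣p∣ {p = inside ∷ p}  {inside ∷ q}  q⊆p =
  trans (+-suc _ _) (cong suc (∣p─q∣+∣q∣≡∣p∣ (drop-∷-⊆ q⊆p)))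
∣p─q∣+∣q∣≡∣p∣ {p = outside ∷ p} {inside ∷ q}  q⊆p with q⊆p here
... | ()

∣p─q∣≡∣p∣∸∣q∣ : ∀ {p q : Subset n} → q ⊆ p → ∣ p ─ q ∣ ≡ ∣ p ∣ ∸ ∣ q ∣
∣p─q∣≡∣p∣∸∣q∣ {q = q} q⊆p = trans (sym (m+n∸n≡m _ ∣ q ∣)) (cong (_∸ ∣ q ∣) (∣p─q∣+∣q∣≡∣p∣ q⊆p))

x∉p⇒∣p∪⁅x⁆∣≡1+∣p∣ : ∀ {x : Fin n} {p} → x ∉ p → ∣ p ∪ ⁅ x ⁆ ∣ ≡ suc ∣ p ∣
x∉p⇒∣p∪⁅x⁆∣≡1+∣p∣ {x = zero}  {inside ∷ p}  x∉p = contradiction here x∉p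
x∉p⇒∣p∪⁅x⁆∣≡1+∣p∣ {x = zero}  {outside ∷ p} x∉p = cong (suc ∘ ∣_∣) (∪-identityʳ p)
x∉p⇒∣p∪⁅x⁆∣≡1+∣p∣ {x = suc x} {inside ∷ p}  x∉p = cong suc (x∉p⇒∣p∪⁅x⁆∣≡1+∣p∣ (x∉p ∘ there))
x∉p⇒∣p∪⁅x⁆∣≡1+∣p∣ {x = suc x} {outside ∷ p} x∉p = x∉p⇒∣p∪⁅x⁆∣≡1+∣p∣ (x∉p ∘ there)

p⊆r∧x∈r⇒p∪⁅x⁆⊆r : ∀ {p r : Subset n} {x} → p ⊆ r → x ∈ r → p ∪ ⁅ x ⁆ ⊆ r
p⊆r∧x∈r⇒p∪⁅x⁆⊆r {p = p} {x = x} p⊆r x∈r y∈ with x∈p∪q⁻ p ⁅ x ⁆ y∈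
... | inj₁ y∈p  = p⊆r y∈p
... | inj₂ y∈⁅x⁆ rewrite x∈⁅y⁆⇒x≡y x y∈⁅x⁆ = x∈r

there-witness : ∀ {s t} {p q : Subset n} → (∃ λ x → x ∈ p × x ∉ q) → ∃ λ x → x ∈ s ∷ p × x ∉ t ∷ q
there-witness (x , x∈p , x∉q) = suc x , there x∈p , λ { (there x∈q) → x∉q x∈q }

∣q∣≤∣p∣∧p≢q⇒∃∈p∉q : ∀ (p q : Subset n) → ∣ q ∣ ≤ ∣ p ∣ → p ≢ q → ∃ λ x → x ∈ p × x ∉ q
∣q∣≤∣p∣∧p≢q⇒∃∈p∉q []            []            _         p≢q = contradiction refl p≢q
∣q∣≤∣p∣∧p≢q⇒∃∈p∉q (inside ∷ p)  (outside ∷ q) _         _   = zero , here , λ ()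
∣q∣≤∣p∣∧p≢q⇒∃∈p∉q (inside ∷ p)  (inside ∷ q)  (s≤s q≤p) p≢q =
  there-witness (∣q∣≤∣p∣∧p≢q⇒∃∈p∉q p q q≤p (p≢q ∘ cong (inside ∷_)))
∣q∣≤∣p∣∧p≢q⇒∃∈p∉q (outside ∷ p) (outside ∷ q) q≤p      p≢q =
  there-witness (∣q∣≤∣p∣∧p≢q⇒∃∈p∉q p q q≤p (p≢q ∘ cong (outside ∷_)))
∣q∣≤∣p∣∧p≢q⇒∃∈p∉q (outside ∷ p) (inside ∷ q)  q<p      _   =
  there-witness (∣q∣≤∣p∣∧p≢q⇒∃∈p∉q p q (<⇒≤ q<p) λ { refl → <-irrefl refl q<p })

Layer : Subset n → Subset n → ℕ → Subset n → Set
Layer L U k y = L ⊆ y × y ⊆ U × ∣ y ∣ ≡ ∣ L ∣ + k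

layer : Subset n → Subset n → ℕ → List (Subset n)
layer []            []            zero    = [ [] ]
layer []            []            (suc k) = []
layer (inside ∷ L)  (inside ∷ U)  k       = map (inside ∷_) (layer L U k)
layer (inside ∷ L)  (outside ∷ U) k       = []
layer (outside ∷ L) (outside ∷ U) k       = map (outside ∷_) (layer L U k)
layer (outside ∷ L) (inside ∷ U)  zero    = map (outside ∷_) (layer L U zero)
layer (outside ∷ L) (inside ∷ U)  (suc k) =
  map (inside ∷_) (layer L U k) ++ map (outside ∷_) (layer L U (suc k))

module _ {L U y : Subset n} where

  Layer-outside : ∀ {u} → Layer L U k y → Layer (outside ∷ L) (u ∷ U) k (outside ∷ y)
  Layer-outside (L⊆y , y⊆U , ∣y∣≡) = out⊆ L⊆y , out⊆ y⊆U , ∣y∣≡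

  Layer-inside : Layer L U k y → Layer (inside ∷ L) (inside ∷ U) k (inside ∷ y)
  Layer-inside (L⊆y , y⊆U , ∣y∣≡) = in⊆in L⊆y , in⊆in y⊆U , cong suc ∣y∣≡

  Layer-new : Layer L U k y → Layer (outside ∷ L) (inside ∷ U) (suc k) (inside ∷ y)
  Layer-new (L⊆y , y⊆U , ∣y∣≡) = out⊆ L⊆y , in⊆in y⊆U , trans (cong suc ∣y∣≡) (sym (+-suc _ _))

  Layer-tail : ∀ {l u b k′} → Layer (l ∷ L) (u ∷ U) k (b ∷ y) → ∣ y ∣ ≡ ∣ L ∣ + k′ → Layer L U k′ y
  Layer-tail (L⊆y , y⊆U , _) ∣y∣≡ = drop-∷-⊆ L⊆y , drop-∷-⊆ y⊆U , ∣y∣≡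

layer-sound : ∀ (L U : Subset n) k → All (Layer L U k) (layer L U k)
layer-sound []            []            zero    = ((λ ()) , (λ ()) , refl) ∷ []
layer-sound []            []            (suc k) = []
layer-sound (inside ∷ L)  (inside ∷ U)  k       = All.map⁺ (All.map Layer-inside (layer-sound L U k))
layer-sound (inside ∷ L)  (outside ∷ U) k       = []
layer-sound (outside ∷ L) (outside ∷ U) k       = All.map⁺ (All.map Layer-outside (layer-sound L U k))
layer-sound (outside ∷ L) (inside ∷ U)  zero    = All.map⁺ (All.map Layer-outside (layer-sound L U zero))
layer-sound (outside ∷ L) (inside ∷ U)  (suc k) =
  All.++⁺ (All.map⁺ (All.map Layer-new (layer-sound L U k)))
          (All.map⁺ (All.map Layer-outside (layer-sound L U (suc k))))

layer-complete : ∀ {L U : Subset n} {k y} → Layer L U k y → y ∈ₗ layer L U k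
layer-complete {L = []} {[]} {zero} {[]} _ = Any.here refl
layer-complete {L = inside ∷ L} {inside ∷ U} {y = inside ∷ y} y∈@(_ , _ , ∣y∣≡) =
  ∈-map⁺ (inside ∷_) (layer-complete (Layer-tail y∈ (suc-injective ∣y∣≡)))
layer-complete {L = inside ∷ L} {y = outside ∷ y} (L⊆y , _) with L⊆y here
... | ()
layer-complete {U = outside ∷ U} {y = inside ∷ y} (_ , y⊆U , _) with y⊆U here
... | ()
layer-complete {L = outside ∷ L} {outside ∷ U} {y = outside ∷ y} y∈@(_ , _ , ∣y∣≡) =
  ∈-map⁺ (outside ∷_) (layer-complete (Layer-tail y∈ ∣y∣≡))
layer-complete {L = outside ∷ L} {inside ∷ U} {zero} {outside ∷ y} y∈@(_ , _ , ∣y∣≡) =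
  ∈-map⁺ (outside ∷_) (layer-complete (Layer-tail y∈ ∣y∣≡))
layer-complete {L = outside ∷ L} {inside ∷ U} {suc k} {outside ∷ y} y∈@(_ , _ , ∣y∣≡) =
  ∈-++⁺ʳ _ (∈-map⁺ (outside ∷_) (layer-complete (Layer-tail y∈ ∣y∣≡)))
layer-complete {L = outside ∷ L} {inside ∷ U} {zero} {inside ∷ y} (L⊆y , _ , ∣y∣≡) =
  contradiction (trans ∣y∣≡ (+-identityʳ ∣ L ∣)) (<⇒≢ (s≤s (p⊆q⇒∣p∣≤∣q∣ (drop-∷-⊆ L⊆y))) ∘ sym)
layer-complete {L = outside ∷ L} {inside ∷ U} {suc k} {inside ∷ y} y∈@(_ , _ , ∣y∣≡) =
  ∈-++⁺ˡ (∈-map⁺ (inside ∷_) (layer-complete (Layer-tail y∈ (suc-injective (trans ∣y∣≡ (+-suc ∣ L ∣ k))))))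

layer-unique : ∀ (L U : Subset n) k → Unique (layer L U k)
layer-unique []            []            zero    = [] ∷ []
layer-unique []            []            (suc k) = []
layer-unique (inside ∷ L)  (inside ∷ U)  k       = Unique.map⁺ ∷-injectiveʳ (layer-unique L U k)
layer-unique (inside ∷ L)  (outside ∷ U) k       = []
layer-unique (outside ∷ L) (outside ∷ U) k       = Unique.map⁺ ∷-injectiveʳ (layer-unique L U k)
layer-unique (outside ∷ L) (inside ∷ U)  zero    = Unique.map⁺ ∷-injectiveʳ (layer-unique L U zero)
layer-unique (outside ∷ L) (inside ∷ U)  (suc k) =
  Unique.++⁺ (Unique.map⁺ ∷-injectiveʳ (layer-unique L U k))
             (Unique.map⁺ ∷-injectiveʳ (layer-unique L U (suc k)))
             heads-differ
  where
  heads-differ : Disjoint (map (inside ∷_) (layer L U k)) (map (outside ∷_) (layer L U (suc k)))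
  heads-differ (v∈ , v∈′) with ∈-map⁻ (inside ∷_) v∈ | ∈-map⁻ (outside ∷_) v∈′
  ... | _ , _ , refl | _ , _ , ()

length-layer : ∀ {L U : Subset n} k → L ⊆ U → length (layer L U k) ≡ ∣ U ─ L ∣ C k
length-layer {L = []}          {[]}          zero    _   = refl
length-layer {L = []}          {[]}          (suc k) _   = refl
length-layer {L = inside ∷ L}  {inside ∷ U}  k       L⊆U =
  trans (length-map _ (layer L U k)) (length-layer k (drop-∷-⊆ L⊆U))
length-layer {L = inside ∷ L}  {outside ∷ U} k       L⊆U with L⊆U here
... | ()
length-layer {L = outside ∷ L} {outside ∷ U} k       L⊆U =
  trans (length-map _ (layer L U k)) (length-layer k (drop-∷-⊆ L⊆U))
length-layer {L = outside ∷ L} {inside ∷ U}  zero    L⊆U =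
  trans (length-map _ (layer L U zero)) (length-layer zero (drop-∷-⊆ L⊆U))
length-layer {L = outside ∷ L} {inside ∷ U}  (suc k) L⊆U = begin
  length (map (inside ∷_) (layer L U k) ++ map (outside ∷_) (layer L U (suc k)))
    ≡⟨ length-++ (map (inside ∷_) (layer L U k)) ⟩
  length (map (inside ∷_) (layer L U k)) + length (map (outside ∷_) (layer L U (suc k)))
    ≡⟨ cong₂ _+_ (length-map _ (layer L U k)) (length-map _ (layer L U (suc k))) ⟩
  length (layer L U k) + length (layer L U (suc k))
    ≡⟨ cong₂ _+_ (length-layer k (drop-∷-⊆ L⊆U)) (length-layer (suc k) (drop-∷-⊆ L⊆U)) ⟩
  ∣ U ─ L ∣ C k + ∣ U ─ L ∣ C suc k
    ≡⟨ nCk+nC[k+1]≡[n+1]C[k+1] ∣ U ─ L ∣ k ⟩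
  suc ∣ U ─ L ∣ C suc k
    ∎
  where open ≡-Reasoning

length≤∣U─L∣Ck : ∀ {L U : Subset n} {k ys} → L ⊆ U → Unique ys → All (Layer L U k) ys →
                 length ys ≤ ∣ U ─ L ∣ C k
length≤∣U─L∣Ck {L = L} {U} {k} {ys} L⊆U uys ys∈ = begin
  length ys              ≤⟨ unique-⊆⇒length≤ uys (layer-complete ∘ All.lookup ys∈) ⟩
  length (layer L U k)   ≡⟨ length-layer k L⊆U ⟩
  ∣ U ─ L ∣ C k          ∎
  where open ≤-Reasoning

length≤nCk : ∀ {ys : List (Subset n)} → Unique ys → All (λ y → ∣ y ∣ ≡ k) ys → length ys ≤ n C k
length≤nCk {n} {k} {ys} uys ∣ys∣≡k =
  subst (λ m → length ys ≤ m C k) (trans (cong ∣_∣ (p─⊥≡p (⊤ {n}))) (∣⊤∣≡n n))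
        (length≤∣U─L∣Ck ⊥⊆ uys (All.map in-layer ∣ys∣≡k))
  where
  in-layer : ∀ {y} → ∣ y ∣ ≡ k → Layer ⊥ ⊤ k y
  in-layer ∣y∣≡k = ⊥⊆ , ⊆⊤ , trans ∣y∣≡k (cong (_+ k) (sym (∣⊥∣≡0 n)))

p∩q≢∅⇒q⊈∁p : ∀ {p q : Subset n} → Nonempty (p ∩ q) → ¬ (q ⊆ ∁ p)
p∩q≢∅⇒q⊈∁p {p = p} {q} (x , x∈p∩q) q⊆∁p = x∈∁p⇒x∉p (q⊆∁p (proj₂ x∈p∧x∈q)) (proj₁ x∈p∧x∈q)
  where x∈p∧x∈q = x∈p∩q⁻ p q x∈p∩q

meets⇒∉layer-∁ : ∀ {A G : Subset n} L k → Nonempty (A ∩ G) → G ∉ₗ layer L (∁ A) k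
meets⇒∉layer-∁ {A = A} L k meets G∈ = p∩q≢∅⇒q⊈∁p meets (proj₁ (proj₂ (All.lookup (layer-sound L (∁ A) k) G∈)))

∣layer∣ : ∀ (L U : Subset n) k {m} → ∣ L ∣ + k ≡ m → All (λ y → ∣ y ∣ ≡ m) (layer L U k)
∣layer∣ L U k ∣L∣+k≡m = All.map (λ (_ , _ , ∣y∣≡) → trans ∣y∣≡ ∣L∣+k≡m) (layer-sound L U k)

length-layer-⊥-∁ : ∀ (A : Subset n) {a} k → ∣ A ∣ ≡ a → length (layer ⊥ (∁ A) k) ≡ (n ∸ a) C k
length-layer-⊥-∁ {n} A {a} k ∣A∣≡a = trans (length-layer {L = ⊥} {∁ A} k ⊥⊆) (cong (_C k) (begin
  ∣ ∁ A ─ ⊥ ∣  ≡⟨ cong ∣_∣ (p─⊥≡p (∁ A)) ⟩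
  ∣ ∁ A ∣      ≡⟨ ∣∁p∣≡n∸∣p∣ A ⟩
  n ∸ ∣ A ∣    ≡⟨ cong (n ∸_) ∣A∣≡a ⟩
  n ∸ a        ∎))
  where open ≡-Reasoning

length-layer-⁅x⁆-∁ : ∀ (A : Subset n) {a x} k → ∣ A ∣ ≡ a → x ∉ A →
                     length (layer ⁅ x ⁆ (∁ A) k) ≡ (n ∸ suc a) C k
length-layer-⁅x⁆-∁ {n} A {a} {x} k ∣A∣≡a x∉A =
  trans (length-layer {L = ⁅ x ⁆} {∁ A} k ⁅x⁆⊆∁A) (cong (_C k) (begin
  ∣ ∁ A ─ ⁅ x ⁆ ∣        ≡⟨ ∣p─q∣≡∣p∣∸∣q∣ ⁅x⁆⊆∁A ⟩
  ∣ ∁ A ∣ ∸ ∣ ⁅ x ⁆ ∣    ≡⟨ cong₂ _∸_ (trans (∣∁p∣≡n∸∣p∣ A) (cong (n ∸_) ∣A∣≡a)) (∣⁅x⁆∣≡1 x) ⟩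
  n ∸ a ∸ 1              ≡⟨ ∸-+-assoc n a 1 ⟩
  n ∸ (a + 1)            ≡⟨ cong (n ∸_) (+-comm a 1) ⟩
  n ∸ suc a              ∎))
  where
  open ≡-Reasoning
  ⁅x⁆⊆∁A : ⁅ x ⁆ ⊆ ∁ A
  ⁅x⁆⊆∁A y∈⁅x⁆ rewrite x∈⁅y⁆⇒x≡y x y∈⁅x⁆ = x∉p⇒x∈∁p x∉A

length+length≤nCk : ∀ {xs ys : List (Subset n)} → Unique xs → Unique ys → Disjoint xs ys →
                    All (λ y → ∣ y ∣ ≡ k) xs → All (λ y → ∣ y ∣ ≡ k) ys → length xs + length ys ≤ n C k
length+length≤nCk {xs = xs} uxs uys xs∩ys=∅ ∣xs∣≡k ∣ys∣≡k =
  subst (_≤ _) (length-++ xs) (length≤nCk (Unique.++⁺ uxs uys xs∩ys=∅) (All.++⁺ ∣xs∣≡k ∣ys∣≡k))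

module _ {b} {𝓖 : List (Subset n)} (u𝓖 : Unique 𝓖) (∣𝓖∣≡b : All (λ G → ∣ G ∣ ≡ b) 𝓖) where

  one-set-bound : ∀ {A a} → ∣ A ∣ ≡ a → (∀ {G} → G ∈ₗ 𝓖 → Nonempty (A ∩ G)) → length 𝓖 + (n ∸ a) C b ≤ n C b
  one-set-bound {A} ∣A∣≡a A-meets = subst (λ d → length 𝓖 + d ≤ n C b) (length-layer-⊥-∁ A b ∣A∣≡a)
    (length+length≤nCk u𝓖 (layer-unique ⊥ (∁ A) b)
      (λ (G∈𝓖 , G∈D) → meets⇒∉layer-∁ ⊥ b (A-meets G∈𝓖) G∈D)
      ∣𝓖∣≡b (∣layer∣ ⊥ (∁ A) b (cong (_+ b) (∣⊥∣≡0 n))))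

  two-set-bound : ∀ {A A′ a x} → 1 ≤ b → ∣ A ∣ ≡ a → ∣ A′ ∣ ≡ a → x ∈ A → x ∉ A′ →
                  (∀ {G} → G ∈ₗ 𝓖 → Nonempty (A ∩ G)) → (∀ {G} → G ∈ₗ 𝓖 → Nonempty (A′ ∩ G)) →
                  length 𝓖 + ((n ∸ suc a) C (b ∸ 1) + (n ∸ a) C b) ≤ n C b
  two-set-bound {A} {A′} {a} {x} 1≤b ∣A∣≡a ∣A′∣≡a x∈A x∉A′ A-meets A′-meets =
    subst (λ e+d → length 𝓖 + e+d ≤ n C b)
      (trans (length-++ E) (cong₂ _+_ (length-layer-⁅x⁆-∁ A′ (b ∸ 1) ∣A′∣≡a x∉A′) (length-layer-⊥-∁ A b ∣A∣≡a)))
      (length+length≤nCk u𝓖 (Unique.++⁺ (layer-unique ⁅ x ⁆ (∁ A′) (b ∸ 1)) (layer-unique ⊥ (∁ A) b) E∩D=∅)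
        𝓖∩E++D=∅ ∣𝓖∣≡b (All.++⁺ (∣layer∣ ⁅ x ⁆ (∁ A′) (b ∸ 1) (trans (cong (_+ (b ∸ 1)) (∣⁅x⁆∣≡1 x)) (m+[n∸m]≡n 1≤b)))
                                 (∣layer∣ ⊥ (∁ A) b (cong (_+ b) (∣⊥∣≡0 n)))))
    where
    E = layer ⁅ x ⁆ (∁ A′) (b ∸ 1)
    D = layer ⊥ (∁ A) b
    E∩D=∅ : Disjoint E D
    E∩D=∅ (y∈E , y∈D) = meets⇒∉layer-∁ ⊥ b (x , x∈p∩q⁺ (x∈A , ⁅x⁆⊆y (x∈⁅x⁆ x))) y∈D
      where ⁅x⁆⊆y = proj₁ (All.lookup (layer-sound ⁅ x ⁆ (∁ A′) (b ∸ 1)) y∈E)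
    𝓖∩E++D=∅ : Disjoint 𝓖 (E ++ D)
    𝓖∩E++D=∅ (G∈𝓖 , G∈E++D) with ∈-++⁻ E G∈E++D
    ... | inj₁ G∈E = meets⇒∉layer-∁ ⁅ x ⁆ (b ∸ 1) (A′-meets G∈𝓖) G∈E
    ... | inj₂ G∈D = meets⇒∉layer-∁ ⊥ b (A-meets G∈𝓖) G∈D

length-concatMap≤ : ∀ {A B : Set} {f : A → List B} {c xs} → All (λ x → length (f x) ≤ c) xs →
                    length (concatMap f xs) ≤ length xs * c
length-concatMap≤                 []               = z≤n
length-concatMap≤ {f = f} {xs = x ∷ _} (fx≤c ∷ fxs≤c) =
  ≤-trans (≤-reflexive (length-++ (f x))) (+-mono-≤ fx≤c (length-concatMap≤ fxs≤c))

elements : Subset n → List (Fin n)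
elements []            = []
elements (inside ∷ p)  = zero ∷ map suc (elements p)
elements (outside ∷ p) = map suc (elements p)

length-elements : ∀ (p : Subset n) → length (elements p) ≡ ∣ p ∣
length-elements []            = refl
length-elements (inside ∷ p)  = cong suc (trans (length-map suc (elements p)) (length-elements p))
length-elements (outside ∷ p) = trans (length-map suc (elements p)) (length-elements p)

elements⊆ : ∀ (p : Subset n) → All (_∈ p) (elements p)
elements⊆ []            = []
elements⊆ (inside ∷ p)  = here ∷ All.map⁺ (All.map there (elements⊆ p))
elements⊆ (outside ∷ p) = All.map⁺ (All.map there (elements⊆ p))

∈-elements : ∀ {p : Subset n} {x} → x ∈ p → x ∈ₗ elements p
∈-elements {p = inside ∷ p}  here        = Any.here refl
∈-elements {p = inside ∷ p}  (there x∈p) = Any.there (∈-map⁺ suc (∈-elements x∈p))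
∈-elements {p = outside ∷ p} (there x∈p) = ∈-map⁺ suc (∈-elements x∈p)

module CoverTree (𝓖 : List (Subset n)) where

  missed : (S : Subset n) → (∃ λ G → G ∈ₗ 𝓖 × (∀ {i} → i ∈ G → i ∉ S)) ⊎ IsCover S 𝓖
  missed S with All.all? (λ G → nonempty? (S ∩ G)) 𝓖
  ... | yes S-covers = inj₂ (All.lookup S-covers)
  ... | no  S-misses with find (All.¬All⇒Any¬ (λ G → nonempty? (S ∩ G)) 𝓖 S-misses)
  ...   | G , G∈𝓖 , S∩G=∅ = inj₁ (G , G∈𝓖 , λ i∈G i∈S → S∩G=∅ (_ , x∈p∩q⁺ (i∈S , i∈G)))

  branches : Subset n → ℕ → List (Subset n)
  branches S zero    = [ S ]
  branches S (suc m) with missed S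
  ... | inj₁ (G , _) = concatMap (λ i → branches (S ∪ ⁅ i ⁆) m) (elements G)
  ... | inj₂ _       = []

  length-branches : ∀ {b} → All (λ G → ∣ G ∣ ≡ b) 𝓖 → ∀ S m → length (branches S m) ≤ b ^ m
  length-branches ∣𝓖∣≡b S zero = ≤-refl
  length-branches {b} ∣𝓖∣≡b S (suc m) with missed S
  ... | inj₂ _              = z≤n
  ... | inj₁ (G , G∈𝓖 , _) = begin
    length (concatMap (λ i → branches (S ∪ ⁅ i ⁆) m) (elements G))
      ≤⟨ length-concatMap≤ (All.universal (λ i → length-branches ∣𝓖∣≡b (S ∪ ⁅ i ⁆) m) (elements G)) ⟩
    length (elements G) * b ^ m
      ≡⟨ cong (_* b ^ m) (trans (length-elements G) (All.lookup ∣𝓖∣≡b G∈𝓖)) ⟩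
    b ^ suc m
      ∎
    where open ≤-Reasoning

  ∣branches∣ : ∀ S m → All (λ T → ∣ T ∣ ≡ ∣ S ∣ + m) (branches S m)
  ∣branches∣ S zero = sym (+-identityʳ ∣ S ∣) ∷ []
  ∣branches∣ S (suc m) with missed S
  ... | inj₂ _                 = []
  ... | inj₁ (G , _ , G∉S) = All.concat⁺ (All.map⁺ (All.map grown (elements⊆ G)))
    where
    grown : ∀ {i} → i ∈ G → All (λ T → ∣ T ∣ ≡ ∣ S ∣ + suc m) (branches (S ∪ ⁅ i ⁆) m)
    grown {i} i∈G = All.map (λ ∣T∣≡ → trans ∣T∣≡ (trans (cong (_+ m) ∣S∪⁅i⁆∣≡) (sym (+-suc ∣ S ∣ m))))
                            (∣branches∣ (S ∪ ⁅ i ⁆) m)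
      where
      ∣S∪⁅i⁆∣≡ : ∣ S ∪ ⁅ i ⁆ ∣ ≡ suc ∣ S ∣
      ∣S∪⁅i⁆∣≡ = x∉p⇒∣p∪⁅x⁆∣≡1+∣p∣ (G∉S i∈G)

  branches-hit : ∀ {t F} → τ≥ t 𝓖 → IsCover F 𝓖 →
                 ∀ S m → S ⊆ F → ∣ S ∣ + m ≤ t → Any (_⊆ F) (branches S m)
  branches-hit τ F-covers S zero    S⊆F _ = Any.here S⊆F
  branches-hit {t} {F} τ F-covers S (suc m) S⊆F ∣S∣+1+m≤t with missed S
  ... | inj₂ S-covers = contradiction (≤-trans (m<m+n ∣ S ∣ z<s) (≤-trans ∣S∣+1+m≤t (τ S S-covers))) (n≮n ∣ S ∣)
  ... | inj₁ (G , G∈𝓖 , G∉S) with F-covers G∈𝓖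
  ...   | i , i∈F∩G = Any.concat⁺ (Any.map⁺ (lose (∈-elements i∈G)
            (branches-hit τ F-covers (S ∪ ⁅ i ⁆) m (p⊆r∧x∈r⇒p∪⁅x⁆⊆r S⊆F i∈F) ∣S∪⁅i⁆∣+m≤t)))
    where
    i∈F = proj₁ (x∈p∩q⁻ F G i∈F∩G)
    i∈G = proj₂ (x∈p∩q⁻ F G i∈F∩G)
    ∣S∪⁅i⁆∣+m≤t : ∣ S ∪ ⁅ i ⁆ ∣ + m ≤ t
    ∣S∪⁅i⁆∣+m≤t = subst (_≤ t) (trans (+-suc ∣ S ∣ m) (cong (_+ m) (sym (x∉p⇒∣p∪⁅x⁆∣≡1+∣p∣ (G∉S i∈G)))))
                    ∣S∣+1+m≤t

cover-family-bound : ∀ {a b t} {𝓕 𝓖 : List (Subset n)} → All (λ G → ∣ G ∣ ≡ b) 𝓖 → τ≥ t 𝓖 → t ≤ a →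
                     Unique 𝓕 → All (λ F → ∣ F ∣ ≡ a) 𝓕 → (∀ {F} → F ∈ₗ 𝓕 → IsCover F 𝓖) →
                     length 𝓕 ≤ b ^ t * ((n ∸ t) C (a ∸ t))
cover-family-bound {n} {a} {b} {t} {𝓕} {𝓖} ∣𝓖∣≡b τ t≤a u𝓕 ∣𝓕∣≡a covers = begin
  length 𝓕                      ≤⟨ unique-⊆⇒length≤ u𝓕 𝓕⊆supersets ⟩
  length supersets              ≤⟨ length-concatMap≤ (All.map (λ {T} → length-supersets T) ∣𝒯∣≡t) ⟩
  length 𝒯 * ((n ∸ t) C (a ∸ t))  ≤⟨ *-monoˡ-≤ _ (length-branches ∣𝓖∣≡b ⊥ t) ⟩
  b ^ t * ((n ∸ t) C (a ∸ t))     ∎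
  where
  open ≤-Reasoning
  open CoverTree 𝓖
  𝒯 = branches ⊥ t
  supersets = concatMap (λ T → layer T ⊤ (a ∸ t)) 𝒯
  ∣𝒯∣≡t : All (λ T → ∣ T ∣ ≡ t) 𝒯
  ∣𝒯∣≡t = All.map (λ ∣T∣≡ → trans ∣T∣≡ (cong (_+ t) (∣⊥∣≡0 n))) (∣branches∣ ⊥ t)
  length-supersets : ∀ T → ∣ T ∣ ≡ t → length (layer T ⊤ (a ∸ t)) ≤ (n ∸ t) C (a ∸ t)
  length-supersets T ∣T∣≡t = ≤-reflexive (trans (length-layer {L = T} {⊤} (a ∸ t) ⊆⊤)
    (cong (_C (a ∸ t)) (trans (∣p─q∣≡∣p∣∸∣q∣ {p = ⊤} {T} ⊆⊤) (cong₂ _∸_ (∣⊤∣≡n n) ∣T∣≡t))))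
  𝓕⊆supersets : 𝓕 ⊆ₗ supersets
  𝓕⊆supersets {F} F∈𝓕 with find (branches-hit τ (covers F∈𝓕) ⊥ t ⊥⊆ (≤-reflexive (cong (_+ t) (∣⊥∣≡0 n))))
  ... | T , T∈𝒯 , T⊆F = Any.concat⁺ (Any.map⁺ (lose T∈𝒯 (layer-complete (T⊆F , ⊆⊤ , ∣F∣≡∣T∣+[a∸t]))))
    where
    ∣F∣≡∣T∣+[a∸t] : ∣ F ∣ ≡ ∣ T ∣ + (a ∸ t)
    ∣F∣≡∣T∣+[a∸t] = trans (All.lookup ∣𝓕∣≡a F∈𝓕)
      (sym (trans (cong (_+ (a ∸ t)) (All.lookup ∣𝒯∣≡t T∈𝒯)) (m+[n∸m]≡n t≤a)))

m+n≤o⇒1+m≤o∸n+1 : ∀ {m n o} → m + n ≤ o → suc m ≤ o ∸ n + 1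
m+n≤o⇒1+m≤o∸n+1 {m} {n} {o} m+n≤o = subst (suc m ≤_) (+-comm 1 (o ∸ n)) (s≤s (m+n≤o⇒m≤o∸n m m+n≤o))

k≤l∧m+[l+n]≤o⇒k+m≤o∸n+1 : ∀ {k l m n o} → k ≤ l → m + (l + n) ≤ o → k + m ≤ o ∸ n + 1
k≤l∧m+[l+n]≤o⇒k+m≤o∸n+1 {k} {l} {m} {n} {o} k≤l m+[l+n]≤o = begin
  k + m      ≤⟨ +-monoˡ-≤ m k≤l ⟩
  l + m      ≤⟨ m+n≤o⇒m≤o∸n (l + m) (subst (_≤ o) (regroup m l n) m+[l+n]≤o) ⟩
  o ∸ n      ≤⟨ m≤m+n (o ∸ n) 1 ⟩
  o ∸ n + 1  ∎
  where
  open ≤-Reasoning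
  regroup : ∀ m l n → m + (l + n) ≡ l + m + n
  regroup = solve-∀

m≤n+o∸2⇒m∸o<n∸1 : ∀ {m n o} → 2 ≤ n → m ≤ n + o ∸ 2 → m ∸ o < n ∸ 1
m≤n+o∸2⇒m∸o<n∸1 {m} {suc (suc n)} {o} (s≤s (s≤s _)) m≤n+o =
  s≤s (subst (m ∸ o ≤_) (m+n∸n≡m n o) (∸-monoˡ-≤ o m≤n+o))

cross-intersecting-bound : ∀ {a b t n} → 1 ≤ b → t ≤ a → b ^ t * n ^ (a ∸ t) ≤ (n ∸ suc a) C (b ∸ 1) →
  ∀ (𝓕 𝓖 : List (Subset n)) → Unique 𝓕 → Unique 𝓖 →
  All (λ F → ∣ F ∣ ≡ a) 𝓕 → All (λ G → ∣ G ∣ ≡ b) 𝓖 →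
  CrossIntersecting 𝓕 𝓖 → τ≥ 1 𝓕 → τ≥ t 𝓖 →
  length 𝓕 + length 𝓖 ≤ (n C b) ∸ ((n ∸ a) C b) + 1
cross-intersecting-bound {n = n} _ _ _ [] _ _ _ _ _ _ τ𝓕 _ =
  contradiction (subst (1 ≤_) (∣⊥∣≡0 n) (τ𝓕 ⊥ λ ())) λ ()
cross-intersecting-bound _ _ _ (A ∷ []) _ _ u𝓖 (∣A∣≡a ∷ []) ∣𝓖∣≡b cross _ _ =
  m+n≤o⇒1+m≤o∸n+1 (one-set-bound u𝓖 ∣𝓖∣≡b ∣A∣≡a (cross (Any.here refl)))
cross-intersecting-bound {a} {b} {t} {n} 1≤b t≤a large 𝓕@(A ∷ A′ ∷ _) 𝓖
  u𝓕@((A≢A′ ∷ _) ∷ _) u𝓖 ∣𝓕∣≡a@(∣A∣≡a ∷ ∣A′∣≡a ∷ _) ∣𝓖∣≡b cross _ τ𝓖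
  with ∣q∣≤∣p∣∧p≢q⇒∃∈p∉q A A′ (≤-reflexive (trans ∣A′∣≡a (sym ∣A∣≡a))) A≢A′
... | x , x∈A , x∉A′ = k≤l∧m+[l+n]≤o⇒k+m≤o∸n+1 𝓕-bound
  (two-set-bound u𝓖 ∣𝓖∣≡b 1≤b ∣A∣≡a ∣A′∣≡a x∈A x∉A′ (cross (Any.here refl)) (cross (Any.there (Any.here refl))))
  where
  open ≤-Reasoning
  𝓕-bound : length 𝓕 ≤ (n ∸ suc a) C (b ∸ 1)
  𝓕-bound = begin
    length 𝓕                         ≤⟨ cover-family-bound ∣𝓖∣≡b τ𝓖 t≤a u𝓕 ∣𝓕∣≡a (λ F∈𝓕 → cross F∈𝓕) ⟩
    b ^ t * ((n ∸ t) C (a ∸ t))      ≤⟨ *-monoʳ-≤ (b ^ t) (nCk≤n^k (n ∸ t) (a ∸ t)) ⟩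
    b ^ t * (n ∸ t) ^ (a ∸ t)        ≤⟨ *-monoʳ-≤ (b ^ t) (^-monoˡ-≤ (a ∸ t) (m∸n≤m n t)) ⟩
    b ^ t * n ^ (a ∸ t)              ≤⟨ large ⟩
    (n ∸ suc a) C (b ∸ 1)            ∎

proposition1 : ∀ (a b t : ℕ) → 2 ≤ b → 2 ≤ t → t ≤ a → a ≤ b + t ∸ 2 →
    ∃ λ (n₀ : ℕ) → ∀ (n : ℕ) → n₀ ≤ n →
      ∀ (𝓕 𝓖 : List (Subset n)) →
      Unique 𝓕 → Unique 𝓖 →
      All (λ F → ∣ F ∣ ≡ a) 𝓕 → All (λ G → ∣ G ∣ ≡ b) 𝓖 →
      CrossIntersecting 𝓕 𝓖 → τ≥ 1 𝓕 → τ≥ t 𝓖 →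
      length 𝓕 + length 𝓖 ≤ (n C b) ∸ ((n ∸ a) C b) + 1
proposition1 a b t 2≤b _ t≤a a≤b+t∸2 =
  let N₀ , dominates = C-dominates-poly (b ^ t) (suc a) (a ∸ t) (b ∸ 1) (m≤n+o∸2⇒m∸o<n∸1 2≤b a≤b+t∸2)
  in  N₀ , λ n N₀≤n → cross-intersecting-bound (≤-trans (s≤s z≤n) 2≤b) t≤a (dominates n N₀≤n)
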